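{- Let $A,B$ be $n\times n\times n$ integer hypermatrices such that $\Xi(A)$ and $\Xi(B)$ are corner-sum hypermatrices of order $n$. Then $A\preceq_B B$ if and only if $\Delta(A)_{i,j,k}\le\Delta(B)_{i,j,k}$ for all $i,k\in[n]$ and $j\in[ik]$.
   Context: $\Xi(A)_{i,j,k}=\sum_{a\le i,b\le j,c\le k}A_{a,b,c}$ for $i,j,k\in[0,n]$. A corner-sum hypermatrix of order $n$ is an integer array $C$ indexed by $[0,n]^3$ with $C_{i,j,0}=C_{i,0,j}=C_{0,i,j}=0$, $C_{i,j,n}=C_{i,n,j}=C_{n,i,j}=ij$ for all $i,j\in[0,n]$, and for all $i,j\in[0,n]$, $1\le k\le n$, each of $C_{i,j,k}-C_{i,j,k-1}$, $C_{i,k,j}-C_{i,k-1,j}$, $C_{k,i,j}-C_{k-1,i,j}$ in $\{\max(0,i+j-n),\dots,\min(i,j)\}$. A positive T-block is an $n\times n\times n$ hypermatrix $T$ for which there exist $i_1<i_2$, $j_1<j_2$, $k_1<k_2$ in $[n]$ such that $T$ is zero outside $\{i_1,i_2\}\times\{j_1,j_2\}\times\{k_1,k_2\}$, $T_{i_1,j_1,k_1}=T_{i_2,j_2,k_1}=1$, $T_{i_1,j_2,k_1}=T_{i_2,j_1,k_1}=-1$, and $T_{i,j,k_2}=-T_{i,j,k_1}$. $A\preceq_B B$ iff $A-B$ is a sum of finitely many positive T-blocks. $P(A)_{i,j,k}=\sum_{a=1}^i\sum_{b=1}^k A_{a,j,b}$ (its entries are non-negative under the hypothesis). $\Delta(A)_{i,*,k}$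 is the weakly increasing sequence in which each $j\in[n]$ occurs exactly $P(A)_{i,j,k}$ times (it has $ik$ terms), and $\Delta(A)_{i,j,k}$ denotes its $j$-th term. -}

module Defs where

open import Data.Nat as ℕ using (ℕ; zero; suc; _∸_; _<?_)
open import Data.Integer as ℤ using (ℤ; +_; -_; _-_; ∣_∣)
open import Data.Fin using (Fin; fromℕ<) renaming (_<_ to _<ᶠ_)
open import Data.Maybe using (Maybe; just; nothing)
open import Data.List using (List; []; _∷_; map; concatMap; replicate; upTo)
open import Data.List.Relation.Unary.All using (All)
open import Data.Product using (Σ; _×_; ∃; ∃-syntax)
open import Data.Sum using (_⊎_)
open import Relation.Binary.PropositionalEquality using (_≡_)
open import Relation.Nullary using (¬_; yes; no)

-- An n×n×n integer hypermatrix; entry (i,j,k) ∈ [n]^3 is stored at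
-- (fromℕ (i-1), fromℕ (j-1), fromℕ (k-1)).
Hypermatrix : ℕ → Set
Hypermatrix n = Fin n → Fin n → Fin n → ℤ

toIdx : (n a : ℕ) → Maybe (Fin n)
toIdx n zero = nothing
toIdx n (suc a) with a <? n
... | yes p = just (fromℕ< p)
... | no _ = nothing

-- entry A_{a,b,c} for 1-based natural indices (0 outside [n]^3; only used inside)
entry : ∀ {n} → Hypermatrix n → ℕ → ℕ → ℕ → ℤ
entry {n} A a b c with toIdx n a | toIdx n b | toIdx n c
... | just i | just j | just k = A i j k
... | _ | _ | _ = + 0

sumTo : ℕ → (ℕ → ℤ) → ℤ
sumTo zero f = + 0
sumTo (suc m) f = sumTo m f ℤ.+ f (suc m)

Ξ : ∀ {n} → Hypermatrix n → ℕ → ℕ → ℕ → ℤ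
Ξ A i j k = sumTo i λ a → sumTo j λ b → sumTo k λ c → entry A a b c

InRange : ℕ → ℕ → ℕ → ℤ → Set
InRange n i j d = (+ (i ℕ.+ j ∸ n) ℤ.≤ d) × (d ℤ.≤ + (ℕ._⊓_ i j))

record IsCornerSum (n : ℕ) (C : ℕ → ℕ → ℕ → ℤ) : Set where
  field
    zeroFaces : ∀ i j → i ℕ.≤ n → j ℕ.≤ n →
      (C i j 0 ≡ + 0) × (C i 0 j ≡ + 0) × (C 0 i j ≡ + 0)
    fullFaces : ∀ i j → i ℕ.≤ n → j ℕ.≤ n →
      (C i j n ≡ + (i ℕ.* j)) × (C i n j ≡ + (i ℕ.* j)) × (C n i j ≡ + (i ℕ.* j))
    steps : ∀ i j k → i ℕ.≤ n → j ℕ.≤ n → 1 ℕ.≤ k → k ℕ.≤ n →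
      InRange n i j (C i j k - C i j (k ∸ 1)) ×
      InRange n i j (C i k j - C i (k ∸ 1) j) ×
      InRange n i j (C k i j - C (k ∸ 1) i j)

record IsPosTBlockAt {n : ℕ} (T : Hypermatrix n) (i₁ i₂ j₁ j₂ k₁ k₂ : Fin n) : Set where
  field
    i<i : i₁ <ᶠ i₂
    j<j : j₁ <ᶠ j₂
    k<k : k₁ <ᶠ k₂
    zeroOutside : ∀ i j k →
      ¬ (((i ≡ i₁) ⊎ (i ≡ i₂)) × ((j ≡ j₁) ⊎ (j ≡ j₂)) × ((k ≡ k₁) ⊎ (k ≡ k₂))) →
      T i j k ≡ + 0
    v₁₁ : T i₁ j₁ k₁ ≡ + 1
    v₂₂ : T i₂ j₂ k₁ ≡ + 1
    v₁₂ : T i₁ j₂ k₁ ≡ - + 1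
    v₂₁ : T i₂ j₁ k₁ ≡ - + 1
    flip : ∀ i j → T i j k₂ ≡ - T i j k₁

IsPosTBlock : ∀ {n} → Hypermatrix n → Set
IsPosTBlock {n} T = ∃[ i₁ ] ∃[ i₂ ] ∃[ j₁ ] ∃[ j₂ ] ∃[ k₁ ] ∃[ k₂ ]
  IsPosTBlockAt {n} T i₁ i₂ j₁ j₂ k₁ k₂

sumℤ : List ℤ → ℤ
sumℤ [] = + 0
sumℤ (x ∷ xs) = x ℤ.+ sumℤ xs

_⪯B_ : ∀ {n} → Hypermatrix n → Hypermatrix n → Set
_⪯B_ {n} A B = Σ (List (Hypermatrix n)) λ Ts → All IsPosTBlock Ts ×
  (∀ i j k → A i j k - B i j k ≡ sumℤ (map (λ T → T i j k) Ts))

P : ∀ {n} → Hypermatrix n → ℕ → ℕ → ℕ → ℤ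
P A i j k = sumTo i λ a → sumTo k λ b → entry A a j b

-- Δ(A)_{i,*,k}: weakly increasing list where each j ∈ [n] occurs P(A)_{i,j,k} times
-- (P is non-negative under the hypotheses; ∣_∣ converts to ℕ)
ΔSeq : ∀ {n} → Hypermatrix n → ℕ → ℕ → List ℕ
ΔSeq {n} A i k = concatMap (λ j → replicate ∣ P A i j k ∣ j) (map suc (upTo n))

-- j-th term (1-based) of a list, 0 if out of range
nth : List ℕ → ℕ → ℕ
nth [] _ = 0
nth (x ∷ xs) zero = 0
nth (x ∷ xs) (suc zero) = x
nth (x ∷ xs) (suc (suc j)) = nth xs (suc j)

Δ : ∀ {n} → Hypermatrix n → ℕ → ℕ → ℕ → ℕ
Δ A i j k = nth (ΔSeq A i k) j

-- A positive T-block is the outer product (e_{i₁} − e_{i₂}) ⊗ (e_{j₁} − e_{j₂}) ⊗ (e_{k₁} − e_{k₂}),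
-- so its corner sum is a product of three prefix sums of some e_a − e_b with a < b, each 0 or 1.
-- As Ξ is linear, A ⪯_B B forces Ξ(B) ≤ Ξ(A). Conversely, D = Ξ(A) − Ξ(B) vanishes on the boundary
-- of [0,n]³ and Ξ is inverted by the triple difference ∇³, so summation by parts writes A − B as
-- Σ D(p,q,r) E_{pqr}, where E_{pqr} is the T-block with corners p, p+1 in each direction; when
-- Ξ(B) ≤ Ξ(A) all coefficients are nonnegative.
--
-- For fixed i and k, the step condition on the corner sum makes every P(X)_{i,j,k} nonnegative, and
-- Ξ(X)_{i,J,k} = Σ_{j ≤ J} P(X)_{i,j,k} counts the terms ≤ J of Δ(X)_{i,*,k}, a sequence of length
-- i·k. For two ascending sequences of equal length, one counting function dominates the other
-- exactly when the sequences compare termwise the opposite way.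

module Submission where

open import Defs
open import Data.Nat using (ℕ; _≤_; _*_)
open import Function.Bundles using (_⇔_)

open import Data.Empty using (⊥-elim)
open import Data.Fin as Fin using (Fin; toℕ; fromℕ<)
import Data.Fin.Properties as Finₚ
open import Data.Integer as ℤ using (ℤ; +_; -_; _-_; ∣_∣; +≤+)
import Data.Integer.Properties as ℤₚ
open import Algebra.Properties.CommutativeSemigroup ℤₚ.+-commutativeSemigroup using (interchange)
open import Data.Integer.Tactic.RingSolver using (solve-∀)
open import Data.List using (List; []; _∷_; map; concat; concatMap; replicate; upTo; _++_; [_]; length)
import Data.List.Properties as Listₚ
open import Data.List.Relation.Unary.All as All using (All; []; _∷_)
import Data.List.Relation.Unary.All.Properties as Allₚ
open import Data.Maybe using (Maybe; just; nothing; maybe′)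
open import Data.Nat as ℕ using (zero; suc; _<_; _∸_; z≤n; s≤s; _<?_)
import Data.Nat.Properties as ℕₚ
open import Data.Product using (_×_; _,_; proj₁; proj₂)
open import Data.Sum as Sum using (_⊎_; inj₁; inj₂)
open import Function using (_∘_)
open import Function.Bundles using (mk⇔; Equivalence)
open import Function.Properties.Equivalence using () renaming (trans to ⇔-trans)
open import Relation.Binary.PropositionalEquality hiding ([_]; J)
open import Relation.Nullary using (¬_; yes; no)

sumTo-cong : ∀ m {f g : ℕ → ℤ} → (∀ a → 1 ≤ a → a ≤ m → f a ≡ g a) → sumTo m f ≡ sumTo m g
sumTo-cong zero    f≗g = refl
sumTo-cong (suc m) f≗g =
  cong₂ ℤ._+_ (sumTo-cong m (λ a 1≤a a≤m → f≗g a 1≤a (ℕₚ.m≤n⇒m≤1+n a≤m)))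
              (f≗g (suc m) (s≤s z≤n) ℕₚ.≤-refl)

sumTo-zero : ∀ m → sumTo m (λ _ → + 0) ≡ + 0
sumTo-zero zero    = refl
sumTo-zero (suc m) = cong (ℤ._+ + 0) (sumTo-zero m)

sumTo-+ : ∀ m (f g : ℕ → ℤ) → sumTo m (λ a → f a ℤ.+ g a) ≡ sumTo m f ℤ.+ sumTo m g
sumTo-+ zero    f g = refl
sumTo-+ (suc m) f g = trans (cong (ℤ._+ (f (suc m) ℤ.+ g (suc m))) (sumTo-+ m f g))
                            (interchange (sumTo m f) (sumTo m g) (f (suc m)) (g (suc m)))

sumTo-neg : ∀ m (f : ℕ → ℤ) → sumTo m (λ a → - f a) ≡ - sumTo m f
sumTo-neg zero    f = refl
sumTo-neg (suc m) f = trans (cong (ℤ._+ - f (suc m)) (sumTo-neg m f))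
                            (sym (ℤₚ.neg-distrib-+ (sumTo m f) (f (suc m))))

sumTo-minus : ∀ m (f g : ℕ → ℤ) → sumTo m (λ a → f a - g a) ≡ sumTo m f - sumTo m g
sumTo-minus m f g = trans (sumTo-+ m f (λ a → - g a)) (cong (ℤ._+_ (sumTo m f)) (sumTo-neg m g))

sumTo-*ˡ : ∀ m c (f : ℕ → ℤ) → sumTo m (λ a → c ℤ.* f a) ≡ c ℤ.* sumTo m f
sumTo-*ˡ zero    c f = sym (ℤₚ.*-zeroʳ c)
sumTo-*ˡ (suc m) c f = trans (cong (ℤ._+ c ℤ.* f (suc m)) (sumTo-*ˡ m c f))
                             (sym (ℤₚ.*-distribˡ-+ c (sumTo m f) (f (suc m))))

sumTo-*ʳ : ∀ m c (f : ℕ → ℤ) → sumTo m (λ a → f a ℤ.* c) ≡ sumTo m f ℤ.* c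
sumTo-*ʳ m c f = begin
  sumTo m (λ a → f a ℤ.* c) ≡⟨ sumTo-cong m (λ a _ _ → ℤₚ.*-comm (f a) c) ⟩
  sumTo m (λ a → c ℤ.* f a) ≡⟨ sumTo-*ˡ m c f ⟩
  c ℤ.* sumTo m f           ≡⟨ ℤₚ.*-comm c (sumTo m f) ⟩
  sumTo m f ℤ.* c           ∎
  where open ≡-Reasoning

sumTo-comm : ∀ m k (f : ℕ → ℕ → ℤ) →
  sumTo m (λ a → sumTo k (f a)) ≡ sumTo k (λ b → sumTo m (λ a → f a b))
sumTo-comm zero    k f = sym (sumTo-zero k)
sumTo-comm (suc m) k f = trans (cong (ℤ._+ sumTo k (f (suc m))) (sumTo-comm m k f))
                               (sym (sumTo-+ k (λ b → sumTo m (λ a → f a b)) (f (suc m))))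

sumTo-sumℤ : ∀ {X : Set} (xs : List X) m (h : X → ℕ → ℤ) →
  sumTo m (λ a → sumℤ (map (λ x → h x a) xs)) ≡ sumℤ (map (λ x → sumTo m (h x)) xs)
sumTo-sumℤ []       m h = sumTo-zero m
sumTo-sumℤ (x ∷ xs) m h = trans (sumTo-+ m (h x) (λ a → sumℤ (map (λ x → h x a) xs)))
                                (cong (ℤ._+_ (sumTo m (h x))) (sumTo-sumℤ xs m h))

sumℤ-zeros : ∀ {X : Set} (xs : List X) → sumℤ (map (λ _ → + 0) xs) ≡ + 0
sumℤ-zeros []       = refl
sumℤ-zeros (x ∷ xs) = trans (ℤₚ.+-identityˡ _) (sumℤ-zeros xs)

sumℤ-++ : ∀ {X : Set} (g : X → ℤ) xs ys →
  sumℤ (map g (xs ++ ys)) ≡ sumℤ (map g xs) ℤ.+ sumℤ (map g ys)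
sumℤ-++ g []       ys = sym (ℤₚ.+-identityˡ _)
sumℤ-++ g (x ∷ xs) ys = trans (cong (ℤ._+_ (g x)) (sumℤ-++ g xs ys)) (sym (ℤₚ.+-assoc (g x) _ _))

sumℤ-replicate : ∀ {X : Set} (g : X → ℤ) c x → sumℤ (map g (replicate c x)) ≡ + c ℤ.* g x
sumℤ-replicate g zero    x = refl
sumℤ-replicate g (suc c) x = trans (cong (ℤ._+_ (g x)) (sumℤ-replicate g c x)) (sym (ℤₚ.suc-* (+ c) (g x)))

sumℤ-nonneg : ∀ {X : Set} (g : X → ℤ) {xs} → All (λ x → + 0 ℤ.≤ g x) xs → + 0 ℤ.≤ sumℤ (map g xs)
sumℤ-nonneg g []           = +≤+ z≤n
sumℤ-nonneg g (0≤gx ∷ 0≤Σ) = ℤₚ.+-mono-≤ 0≤gx (sumℤ-nonneg g 0≤Σ)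

map-suc-upTo-suc : ∀ n → map suc (upTo (suc n)) ≡ map suc (upTo n) ++ [ suc n ]
map-suc-upTo-suc n = trans (cong (map suc) (sym (Listₚ.upTo-∷ʳ n))) (Listₚ.map-++ suc (upTo n) [ n ])

concatMap-∷ʳ : ∀ {A B : Set} (f : A → List B) xs x → concatMap f (xs ++ [ x ]) ≡ concatMap f xs ++ f x
concatMap-∷ʳ f xs x = begin
  concat (map f (xs ++ [ x ]))  ≡⟨ cong concat (Listₚ.map-++ f xs [ x ]) ⟩
  concat (map f xs ++ [ f x ])  ≡⟨ Listₚ.concat-++ (map f xs) [ f x ] ⟨
  concatMap f xs ++ f x ++ []   ≡⟨ cong (concatMap f xs ++_) (Listₚ.++-identityʳ (f x)) ⟩
  concatMap f xs ++ f x         ∎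
  where open ≡-Reasoning

sumℤ-concatMap-range : ∀ {X : Set} (g : X → ℤ) (f : ℕ → List X) m →
  sumℤ (map g (concatMap f (map suc (upTo m)))) ≡ sumTo m (λ p → sumℤ (map g (f p)))
sumℤ-concatMap-range g f zero    = refl
sumℤ-concatMap-range g f (suc m) = begin
  sumℤ (map g (concatMap f (map suc (upTo (suc m)))))
    ≡⟨ cong (sumℤ ∘ map g ∘ concatMap f) (map-suc-upTo-suc m) ⟩
  sumℤ (map g (concatMap f (map suc (upTo m) ++ [ suc m ])))
    ≡⟨ cong (sumℤ ∘ map g) (concatMap-∷ʳ f (map suc (upTo m)) (suc m)) ⟩
  sumℤ (map g (concatMap f (map suc (upTo m)) ++ f (suc m)))
    ≡⟨ sumℤ-++ g (concatMap f (map suc (upTo m))) (f (suc m)) ⟩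
  sumℤ (map g (concatMap f (map suc (upTo m)))) ℤ.+ sumℤ (map g (f (suc m)))
    ≡⟨ cong (ℤ._+ sumℤ (map g (f (suc m)))) (sumℤ-concatMap-range g f m) ⟩
  sumTo (suc m) (λ p → sumℤ (map g (f p))) ∎
  where open ≡-Reasoning

All-concatMap-range : ∀ {X : Set} {P : X → Set} (f : ℕ → List X) m →
  (∀ p → 1 ≤ p → p ≤ m → All P (f p)) → All P (concatMap f (map suc (upTo m)))
All-concatMap-range f m All-f = Allₚ.concat⁺ (Allₚ.map⁺ (Allₚ.map⁺
  (All.map (λ {p} p<m → All-f (suc p) (s≤s z≤n) p<m) (Allₚ.all-upTo m))))

sumToℕ : ℕ → (ℕ → ℕ) → ℕ
sumToℕ zero    c = 0
sumToℕ (suc J) c = sumToℕ J c ℕ.+ c (suc J)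

sumToℕ-mono : ∀ (c : ℕ → ℕ) {J n} → J ≤ n → sumToℕ J c ≤ sumToℕ n c
sumToℕ-mono c {n = zero}  z≤n = ℕₚ.≤-refl
sumToℕ-mono c {n = suc n} J≤1+n with ℕₚ.m≤n⇒m<n∨m≡n J≤1+n
... | inj₁ J<1+n = ℕₚ.≤-trans (sumToℕ-mono c (ℕₚ.≤-pred J<1+n)) (ℕₚ.m≤m+n (sumToℕ n c) (c (suc n)))
... | inj₂ refl  = ℕₚ.≤-refl

sumTo-pos : ∀ J (c : ℕ → ℕ) → sumTo J (λ b → + c b) ≡ + sumToℕ J c
sumTo-pos zero    c = refl
sumTo-pos (suc J) c = trans (cong (ℤ._+ + c (suc J)) (sumTo-pos J c))
                            (sym (ℤₚ.pos-+ (sumToℕ J c) (c (suc J))))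

-- Kronecker delta and summation by parts

δ : ℕ → ℕ → ℤ
δ zero    zero    = + 1
δ zero    (suc _) = + 0
δ (suc _) zero    = + 0
δ (suc a) (suc b) = δ a b

δ-refl : ∀ a → δ a a ≡ + 1
δ-refl zero    = refl
δ-refl (suc a) = δ-refl a

δ-≢ : ∀ {a b} → a ≢ b → δ a b ≡ + 0
δ-≢ {zero}  {zero}  a≢b = ⊥-elim (a≢b refl)
δ-≢ {zero}  {suc b} a≢b = refl
δ-≢ {suc a} {zero}  a≢b = refl
δ-≢ {suc a} {suc b} a≢b = δ-≢ (a≢b ∘ cong suc)

δ-sym : ∀ a b → δ a b ≡ δ b a
δ-sym zero    zero    = refl
δ-sym zero    (suc b) = refl
δ-sym (suc a) zero    = refl
δ-sym (suc a) (suc b) = δ-sym a b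

δ-*-≢ : ∀ {a b} → a ≢ b → ∀ c → δ a b ℤ.* c ≡ + 0
δ-*-≢ a≢b c = trans (cong (ℤ._* c) (δ-≢ a≢b)) (ℤₚ.*-zeroˡ c)

sumTo-δ-zero : ∀ m (f : ℕ → ℤ) → sumTo m (λ p → δ 0 p ℤ.* f p) ≡ + 0
sumTo-δ-zero zero    f = refl
sumTo-δ-zero (suc m) f = cong₂ ℤ._+_ (sumTo-δ-zero m f) (ℤₚ.*-zeroˡ (f (suc m)))

sumTo-δ-> : ∀ m {x} (f : ℕ → ℤ) → m < x → sumTo m (λ p → δ x p ℤ.* f p) ≡ + 0
sumTo-δ-> zero    f m<x = refl
sumTo-δ-> (suc m) f m<x = cong₂ ℤ._+_ (sumTo-δ-> m f (ℕₚ.<-trans ℕₚ.≤-refl m<x))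
                                      (δ-*-≢ (ℕₚ.>⇒≢ m<x) (f (suc m)))

sumTo-δ : ∀ m {x} (f : ℕ → ℤ) → 1 ≤ x → x ≤ m → sumTo m (λ p → δ x p ℤ.* f p) ≡ f x
sumTo-δ zero        f 1≤x x≤0 = ⊥-elim (ℕₚ.<-irrefl refl (ℕₚ.≤-trans 1≤x x≤0))
sumTo-δ (suc m) {x} f 1≤x x≤m with ℕₚ.m≤n⇒m<n∨m≡n x≤m
... | inj₁ x<1+m = begin
  sumTo m (λ p → δ x p ℤ.* f p) ℤ.+ δ x (suc m) ℤ.* f (suc m)
    ≡⟨ cong₂ ℤ._+_ (sumTo-δ m f 1≤x (ℕₚ.≤-pred x<1+m)) (δ-*-≢ (ℕₚ.<⇒≢ x<1+m) (f (suc m))) ⟩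
  f x ℤ.+ + 0 ≡⟨ ℤₚ.+-identityʳ (f x) ⟩
  f x         ∎
  where open ≡-Reasoning
... | inj₂ refl = begin
  sumTo m (λ p → δ x p ℤ.* f p) ℤ.+ δ x x ℤ.* f x
    ≡⟨ cong₂ ℤ._+_ (sumTo-δ-> m f ℕₚ.≤-refl) (cong (ℤ._* f x) (δ-refl x)) ⟩
  + 0 ℤ.+ + 1 ℤ.* f x ≡⟨ trans (ℤₚ.+-identityˡ _) (ℤₚ.*-identityˡ (f x)) ⟩
  f x                 ∎
  where open ≡-Reasoning

sumTo-δ-sym : ∀ I p → sumTo I (λ c → δ c p) ≡ sumTo I (λ c → δ p c ℤ.* + 1)
sumTo-δ-sym I p = sumTo-cong I (λ c _ _ → trans (δ-sym c p) (sym (ℤₚ.*-identityʳ (δ p c))))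

-- The prefix sums of e_p − e_q (p < q) are 1 on [p, q) and 0 elsewhere.
sumTo-δ-diff-nonneg : ∀ I {p q} → 1 ≤ p → p < q → + 0 ℤ.≤ sumTo I (λ c → δ c p - δ c q)
sumTo-δ-diff-nonneg I {p} {q} 1≤p p<q
  rewrite sumTo-minus I (λ c → δ c p) (λ c → δ c q) | sumTo-δ-sym I p | sumTo-δ-sym I q
  with q ℕₚ.≤? I | p ℕₚ.≤? I
... | yes q≤I | _
  rewrite sumTo-δ I (λ _ → + 1) 1≤p (ℕₚ.≤-trans (ℕₚ.<⇒≤ p<q) q≤I)
        | sumTo-δ I (λ _ → + 1) (ℕₚ.≤-trans 1≤p (ℕₚ.<⇒≤ p<q)) q≤I = +≤+ z≤n
... | no q≰I  | yes p≤I
  rewrite sumTo-δ I (λ _ → + 1) 1≤p p≤I | sumTo-δ-> I (λ _ → + 1) (ℕₚ.≰⇒> q≰I) = +≤+ z≤n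
... | no q≰I  | no p≰I
  rewrite sumTo-δ-> I (λ _ → + 1) (ℕₚ.≰⇒> p≰I) | sumTo-δ-> I (λ _ → + 1) (ℕₚ.≰⇒> q≰I) = +≤+ z≤n

∇ : (ℕ → ℤ) → ℕ → ℤ
∇ f x = f (suc x) - f x

∇-sub : ∀ (f g : ℕ → ℤ) x → ∇ (λ p → f p - g p) x ≡ ∇ f x - ∇ g x
∇-sub f g x = interchange-minus (f (suc x)) (g (suc x)) (f x) (g x)
  where
  interchange-minus : ∀ a b c d → (a - b) - (c - d) ≡ (a - c) - (b - d)
  interchange-minus = solve-∀

∇-sumTo : ∀ (f : ℕ → ℤ) x → ∇ (λ p → sumTo p f) x ≡ f (suc x)
∇-sumTo f x = [a+b]-a≡b (sumTo x f) (f (suc x))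
  where
  [a+b]-a≡b : ∀ a b → (a ℤ.+ b) - a ≡ b
  [a+b]-a≡b = solve-∀

∇-weight : ℕ → ℕ → ℤ
∇-weight x p = δ (suc x) p - δ x p

sumTo-∇ : ∀ m {x} (f : ℕ → ℤ) → x ≤ m → f 0 ≡ + 0 → f (suc m) ≡ + 0 →
  sumTo m (λ p → ∇-weight x p ℤ.* f p) ≡ ∇ f x
sumTo-∇ m {x} f x≤m f0≡0 f[1+m]≡0 = begin
  sumTo m (λ p → ∇-weight x p ℤ.* f p)
    ≡⟨ sumTo-cong m (λ p _ _ → *-distribʳ-minus (δ (suc x) p) (δ x p) (f p)) ⟩
  sumTo m (λ p → δ (suc x) p ℤ.* f p - δ x p ℤ.* f p)
    ≡⟨ sumTo-minus m _ _ ⟩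
  sumTo m (λ p → δ (suc x) p ℤ.* f p) - sumTo m (λ p → δ x p ℤ.* f p)
    ≡⟨ cong₂ _-_ sift-at-1+x (sift x≤m) ⟩
  ∇ f x ∎
  where
  open ≡-Reasoning
  *-distribʳ-minus : ∀ a b c → (a - b) ℤ.* c ≡ a ℤ.* c - b ℤ.* c
  *-distribʳ-minus = solve-∀
  sift-at-1+x : sumTo m (λ p → δ (suc x) p ℤ.* f p) ≡ f (suc x)
  sift-at-1+x with ℕₚ.m≤n⇒m<n∨m≡n x≤m
  ... | inj₁ x<m  = sumTo-δ m f (s≤s z≤n) x<m
  ... | inj₂ refl = trans (sumTo-δ-> m f ℕₚ.≤-refl) (sym f[1+m]≡0)
  sift : ∀ {y} → y ≤ m → sumTo m (λ p → δ y p ℤ.* f p) ≡ f y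
  sift {zero}  _   = trans (sumTo-δ-zero m f) (sym f0≡0)
  sift {suc _} y≤m = sumTo-δ m f (s≤s z≤n) y≤m

∇³ : (ℕ → ℕ → ℕ → ℤ) → ℕ → ℕ → ℕ → ℤ
∇³ F x y z = ∇ (λ r → ∇ (λ q → ∇ (λ p → F p q r) x) y) z

∇³-sub : ∀ (F G : ℕ → ℕ → ℕ → ℤ) x y z →
  ∇³ (λ p q r → F p q r - G p q r) x y z ≡ ∇³ F x y z - ∇³ G x y z
∇³-sub F G x y z = begin
  ∇³ (λ p q r → F p q r - G p q r) x y z
    ≡⟨ cong₂ _-_ (cong₂ _-_ (sub₁ (suc y) (suc z)) (sub₁ y (suc z)))
                 (cong₂ _-_ (sub₁ (suc y) z) (sub₁ y z)) ⟩
  ∇ (λ r → ∇ (λ q → F₁ q r - G₁ q r) y) z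
    ≡⟨ cong₂ _-_ (∇-sub (λ q → F₁ q (suc z)) (λ q → G₁ q (suc z)) y)
                 (∇-sub (λ q → F₁ q z) (λ q → G₁ q z) y) ⟩
  ∇ (λ r → ∇ (λ q → F₁ q r) y - ∇ (λ q → G₁ q r) y) z
    ≡⟨ ∇-sub (λ r → ∇ (λ q → F₁ q r) y) (λ r → ∇ (λ q → G₁ q r) y) z ⟩
  ∇³ F x y z - ∇³ G x y z ∎
  where
  open ≡-Reasoning
  F₁ G₁ : ℕ → ℕ → ℤ
  F₁ q r = ∇ (λ p → F p q r) x
  G₁ q r = ∇ (λ p → G p q r) x
  sub₁ : ∀ q r → ∇ (λ p → F p q r - G p q r) x ≡ F₁ q r - G₁ q r
  sub₁ q r = ∇-sub (λ p → F p q r) (λ p → G p q r) x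

record VanishesOnBoundary (N : ℕ) (F : ℕ → ℕ → ℕ → ℤ) : Set where
  field
    face₁ : ∀ q r → q ≤ N → r ≤ N → F 0 q r ≡ + 0 × F N q r ≡ + 0
    face₂ : ∀ p r → p ≤ N → r ≤ N → F p 0 r ≡ + 0 × F p N r ≡ + 0
    face₃ : ∀ p q → p ≤ N → q ≤ N → F p q 0 ≡ + 0 × F p q N ≡ + 0

sumTo³-∇³ : ∀ m (F : ℕ → ℕ → ℕ → ℤ) → VanishesOnBoundary (suc m) F →
  ∀ {x y z} → x ≤ m → y ≤ m → z ≤ m →
  sumTo m (λ r → sumTo m (λ q → sumTo m (λ p →
    F p q r ℤ.* (∇-weight x p ℤ.* ∇-weight y q ℤ.* ∇-weight z r))))
  ≡ ∇³ F x y z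
sumTo³-∇³ m F F-vanishes {x} {y} {z} x≤m y≤m z≤m = begin
  sumTo m (λ r → sumTo m (λ q → sumTo m (λ p → F p q r ℤ.* (wˣ p ℤ.* wʸ q ℤ.* wᶻ r))))
    ≡⟨ sumTo-cong m (λ r _ _ → sumTo-cong m (λ q _ _ → sumTo-cong m (λ p _ _ →
         reassoc (F p q r) (wˣ p) (wʸ q) (wᶻ r)))) ⟩
  sumTo m (λ r → sumTo m (λ q → sumTo m (λ p → wᶻ r ℤ.* (wʸ q ℤ.* (wˣ p ℤ.* F p q r)))))
    ≡⟨ sumTo-cong m (λ r _ _ → sumTo-cong m (λ q _ _ →
         trans (sumTo-*ˡ m (wᶻ r) _) (cong (wᶻ r ℤ.*_) (sumTo-*ˡ m (wʸ q) _)))) ⟩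
  sumTo m (λ r → sumTo m (λ q → wᶻ r ℤ.* (wʸ q ℤ.* sumTo m (λ p → wˣ p ℤ.* F p q r))))
    ≡⟨ sumTo-cong m (λ r _ r≤m → trans
         (sumTo-cong m (λ q _ q≤m → cong (λ s → wᶻ r ℤ.* (wʸ q ℤ.* s)) (level₁ (≤suc q≤m) (≤suc r≤m))))
         (sumTo-*ˡ m (wᶻ r) _)) ⟩
  sumTo m (λ r → wᶻ r ℤ.* sumTo m (λ q → wʸ q ℤ.* ∇₁ q r))
    ≡⟨ sumTo-cong m (λ r _ r≤m → cong (wᶻ r ℤ.*_) (level₂ (≤suc r≤m))) ⟩
  sumTo m (λ r → wᶻ r ℤ.* ∇₂ r)
    ≡⟨ level₃ ⟩
  ∇³ F x y z ∎
  where
  open ≡-Reasoning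
  open VanishesOnBoundary F-vanishes
  wˣ wʸ wᶻ : ℕ → ℤ
  wˣ = ∇-weight x
  wʸ = ∇-weight y
  wᶻ = ∇-weight z
  reassoc : ∀ f a b c → f ℤ.* (a ℤ.* b ℤ.* c) ≡ c ℤ.* (b ℤ.* (a ℤ.* f))
  reassoc = solve-∀
  ≤suc : ∀ {a} → a ≤ m → a ≤ suc m
  ≤suc = ℕₚ.m≤n⇒m≤1+n
  ∇₁ : ℕ → ℕ → ℤ
  ∇₁ q r = ∇ (λ p → F p q r) x
  ∇₂ : ℕ → ℤ
  ∇₂ r = ∇ (λ q → ∇₁ q r) y
  ∇₁-vanishes : ∀ {q r} → (∀ p → p ≤ suc m → F p q r ≡ + 0) → ∇₁ q r ≡ + 0
  ∇₁-vanishes F≡0 = cong₂ _-_ (F≡0 _ (s≤s x≤m)) (F≡0 _ (≤suc x≤m))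
  ∇₂-vanishes : ∀ {r} → (∀ p q → p ≤ suc m → q ≤ suc m → F p q r ≡ + 0) → ∇₂ r ≡ + 0
  ∇₂-vanishes F≡0 = cong₂ _-_ (∇₁-vanishes (λ p p≤ → F≡0 p _ p≤ (s≤s y≤m)))
                              (∇₁-vanishes (λ p p≤ → F≡0 p _ p≤ (≤suc y≤m)))
  level₁ : ∀ {q r} → q ≤ suc m → r ≤ suc m → sumTo m (λ p → wˣ p ℤ.* F p q r) ≡ ∇₁ q r
  level₁ {q} {r} q≤ r≤ = sumTo-∇ m (λ p → F p q r) x≤m (proj₁ (face₁ q r q≤ r≤)) (proj₂ (face₁ q r q≤ r≤))
  level₂ : ∀ {r} → r ≤ suc m → sumTo m (λ q → wʸ q ℤ.* ∇₁ q r) ≡ ∇₂ r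
  level₂ {r} r≤ = sumTo-∇ m (λ q → ∇₁ q r) y≤m
    (∇₁-vanishes (λ p p≤ → proj₁ (face₂ p r p≤ r≤))) (∇₁-vanishes (λ p p≤ → proj₂ (face₂ p r p≤ r≤)))
  level₃ : sumTo m (λ r → wᶻ r ℤ.* ∇₂ r) ≡ ∇³ F x y z
  level₃ = sumTo-∇ m ∇₂ z≤m
    (∇₂-vanishes (λ p q p≤ q≤ → proj₁ (face₃ p q p≤ q≤))) (∇₂-vanishes (λ p q p≤ q≤ → proj₂ (face₃ p q p≤ q≤)))

-- Ascending sequences and their counting functions

ascending : ℕ → (ℕ → ℕ) → List ℕ
ascending n c = concatMap (λ j → replicate (c j) j) (map suc (upTo n))

ascending-suc : ∀ n c → ascending (suc n) c ≡ ascending n c ++ replicate (c (suc n)) (suc n)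
ascending-suc n c = trans (cong (concatMap (λ j → replicate (c j) j)) (map-suc-upTo-suc n))
                          (concatMap-∷ʳ (λ j → replicate (c j) j) (map suc (upTo n)) (suc n))

length-ascending : ∀ n c → length (ascending n c) ≡ sumToℕ n c
length-ascending zero    c = refl
length-ascending (suc n) c = begin
  length (ascending (suc n) c)                             ≡⟨ cong length (ascending-suc n c) ⟩
  length (ascending n c ++ replicate (c (suc n)) (suc n))  ≡⟨ Listₚ.length-++ (ascending n c) ⟩
  length (ascending n c) ℕ.+ length (replicate (c (suc n)) (suc n))
    ≡⟨ cong₂ ℕ._+_ (length-ascending n c) (Listₚ.length-replicate (c (suc n))) ⟩
  sumToℕ (suc n) c                                         ∎
  where open ≡-Reasoning

nth-++ˡ : ∀ xs ys {m} → m ≤ length xs → nth (xs ++ ys) m ≡ nth xs m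
nth-++ˡ []       []       z≤n = refl
nth-++ˡ []       (y ∷ ys) z≤n = refl
nth-++ˡ (x ∷ xs) ys {zero}        _            = refl
nth-++ˡ (x ∷ xs) ys {suc zero}    _            = refl
nth-++ˡ (x ∷ xs) ys {suc (suc m)} (s≤s m<∣xs∣) = nth-++ˡ xs ys m<∣xs∣

nth-++ʳ : ∀ xs ys {m} → length xs < m → nth (xs ++ ys) m ≡ nth ys (m ∸ length xs)
nth-++ʳ []       ys               _              = refl
nth-++ʳ (x ∷ xs) ys {suc (suc m)} (s≤s ∣xs∣<1+m) = nth-++ʳ xs ys ∣xs∣<1+m

nth-replicate : ∀ c (x : ℕ) {m} → 1 ≤ m → m ≤ c → nth (replicate c x) m ≡ x
nth-replicate (suc c) x {suc zero}    _ _           = refl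
nth-replicate (suc c) x {suc (suc m)} _ (s≤s 1+m≤c) = nth-replicate c x (s≤s z≤n) 1+m≤c

nth-ascending-init : ∀ n c {m} → m ≤ sumToℕ n c → nth (ascending (suc n) c) m ≡ nth (ascending n c) m
nth-ascending-init n c m≤S rewrite ascending-suc n c =
  nth-++ˡ (ascending n c) _ (subst (_ ≤_) (sym (length-ascending n c)) m≤S)

nth-ascending-last : ∀ n c {m} → sumToℕ n c < m → m ≤ sumToℕ (suc n) c →
  nth (ascending (suc n) c) m ≡ suc n
nth-ascending-last n c {m} S<m m≤S′ rewrite ascending-suc n c = begin
  nth (ascending n c ++ replicate (c (suc n)) (suc n)) m
    ≡⟨ nth-++ʳ (ascending n c) _ (subst (_< m) (sym (length-ascending n c)) S<m) ⟩
  nth (replicate (c (suc n)) (suc n)) (m ∸ length (ascending n c))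
    ≡⟨ cong (λ l → nth (replicate (c (suc n)) (suc n)) (m ∸ l)) (length-ascending n c) ⟩
  nth (replicate (c (suc n)) (suc n)) (m ∸ sumToℕ n c)
    ≡⟨ nth-replicate (c (suc n)) (suc n) (ℕₚ.m<n⇒0<n∸m S<m) m∸S≤c ⟩
  suc n ∎
  where
  open ≡-Reasoning
  m∸S≤c : m ∸ sumToℕ n c ≤ c (suc n)
  m∸S≤c = ℕₚ.≤-trans (ℕₚ.∸-monoˡ-≤ (sumToℕ n c) m≤S′)
                     (ℕₚ.≤-reflexive (ℕₚ.m+n∸m≡n (sumToℕ n c) (c (suc n))))

nth-ascending-≤⇔ : ∀ n c {m J} → m ≤ sumToℕ n c → J ≤ n →
  nth (ascending n c) m ≤ J ⇔ m ≤ sumToℕ J c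
nth-ascending-≤⇔ zero    c m≤0 z≤n = mk⇔ (λ _ → m≤0) (λ _ → z≤n)
nth-ascending-≤⇔ (suc n) c {m} {J} m≤S′ J≤1+n with m ℕₚ.≤? sumToℕ n c | ℕₚ.m≤n⇒m<n∨m≡n J≤1+n
... | yes m≤S | inj₁ J<1+n rewrite nth-ascending-init n c m≤S =
  nth-ascending-≤⇔ n c m≤S (ℕₚ.≤-pred J<1+n)
... | yes m≤S | inj₂ refl  rewrite nth-ascending-init n c m≤S =
  mk⇔ (λ _ → m≤S′) (λ _ → ℕₚ.m≤n⇒m≤1+n (Equivalence.from (nth-ascending-≤⇔ n c m≤S ℕₚ.≤-refl) m≤S))
... | no m≰S  | inj₁ J<1+n rewrite nth-ascending-last n c (ℕₚ.≰⇒> m≰S) m≤S′ =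
  mk⇔ (λ 1+n≤J → ⊥-elim (ℕₚ.≤⇒≯ (ℕₚ.≤-pred J<1+n) 1+n≤J))
      (λ m≤SJ → ⊥-elim (m≰S (ℕₚ.≤-trans m≤SJ (sumToℕ-mono c (ℕₚ.≤-pred J<1+n)))))
... | no m≰S  | inj₂ refl  rewrite nth-ascending-last n c (ℕₚ.≰⇒> m≰S) m≤S′ =
  mk⇔ (λ _ → m≤S′) (λ _ → ℕₚ.≤-refl)

ascending-dominance : ∀ n (c d : ℕ → ℕ) → sumToℕ n c ≡ sumToℕ n d →
  (∀ J → J ≤ n → sumToℕ J d ≤ sumToℕ J c) ⇔
  (∀ m → 1 ≤ m → m ≤ sumToℕ n c → nth (ascending n c) m ≤ nth (ascending n d) m)
ascending-dominance n c d Sc≡Sd = mk⇔ to from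
  where
  to : (∀ J → J ≤ n → sumToℕ J d ≤ sumToℕ J c) →
       ∀ m → 1 ≤ m → m ≤ sumToℕ n c → nth (ascending n c) m ≤ nth (ascending n d) m
  to d≤c m _ m≤Sc = Equivalence.from (nth-ascending-≤⇔ n c m≤Sc J≤n) m≤SJc
    where
    m≤Sd : m ≤ sumToℕ n d
    m≤Sd = subst (m ≤_) Sc≡Sd m≤Sc
    J : ℕ
    J = nth (ascending n d) m
    J≤n : J ≤ n
    J≤n = Equivalence.from (nth-ascending-≤⇔ n d m≤Sd ℕₚ.≤-refl) m≤Sd
    m≤SJc : m ≤ sumToℕ J c
    m≤SJc = ℕₚ.≤-trans (Equivalence.to (nth-ascending-≤⇔ n d m≤Sd J≤n) ℕₚ.≤-refl) (d≤c J J≤n)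
  from : (∀ m → 1 ≤ m → m ≤ sumToℕ n c → nth (ascending n c) m ≤ nth (ascending n d) m) →
         ∀ J → J ≤ n → sumToℕ J d ≤ sumToℕ J c
  from c≤d J J≤n with sumToℕ J d in SJd≡m
  ... | zero  = z≤n
  ... | suc m = Equivalence.to (nth-ascending-≤⇔ n c m≤Sc J≤n)
                  (ℕₚ.≤-trans (c≤d (suc m) (s≤s z≤n) m≤Sc)
                              (Equivalence.from (nth-ascending-≤⇔ n d m≤Sd J≤n) (ℕₚ.≤-reflexive (sym SJd≡m))))
    where
    m≤Sd : suc m ≤ sumToℕ n d
    m≤Sd = subst (_≤ sumToℕ n d) SJd≡m (sumToℕ-mono d J≤n)
    m≤Sc : suc m ≤ sumToℕ n c
    m≤Sc = subst (suc m ≤_) (sym Sc≡Sd) m≤Sd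

_⪯Ξ_ : ∀ {n} → Hypermatrix n → Hypermatrix n → Set
_⪯Ξ_ {n} A B = ∀ I J K → 1 ≤ I → I ≤ n → 1 ≤ J → J ≤ n → 1 ≤ K → K ≤ n → Ξ B I J K ℤ.≤ Ξ A I J K

_⪯Δ_ : ∀ {n} → Hypermatrix n → Hypermatrix n → Set
_⪯Δ_ {n} A B = ∀ i k j → 1 ≤ i → i ≤ n → 1 ≤ k → k ≤ n → 1 ≤ j → j ≤ i * k → Δ A i j k ≤ Δ B i j k

Ξ≡sumTo-P : ∀ {n} (X : Hypermatrix n) I J K → Ξ X I J K ≡ sumTo J (λ b → P X I b K)
Ξ≡sumTo-P X I J K = sumTo-comm I J (λ a b → sumTo K (entry X a b))

-- Δ(X)_{I,*,K} is ascending n multiplicity, and Ξ(X)_{I,J,K} counts its terms ≤ J.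
module Slice {n} {X : Hypermatrix n} (CX : IsCornerSum n (Ξ X)) {I K} (I≤n : I ≤ n) (K≤n : K ≤ n) where
  open IsCornerSum CX

  multiplicity : ℕ → ℕ
  multiplicity b = ∣ P X I b K ∣

  P-nonneg : ∀ b → 1 ≤ b → b ≤ n → + 0 ℤ.≤ P X I b K
  P-nonneg (suc b) 1≤b b≤n = subst (+ 0 ℤ.≤_) Ξ-step≡P (ℤₚ.≤-trans (+≤+ z≤n) lower-bound)
    where
    lower-bound : + (I ℕ.+ K ∸ n) ℤ.≤ Ξ X I (suc b) K - Ξ X I b K
    lower-bound = proj₁ (proj₁ (proj₂ (steps I K (suc b) I≤n K≤n 1≤b b≤n)))
    Ξ-step≡P : Ξ X I (suc b) K - Ξ X I b K ≡ P X I (suc b) K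
    Ξ-step≡P = trans (cong₂ _-_ (Ξ≡sumTo-P X I (suc b) K) (Ξ≡sumTo-P X I b K))
                     (∇-sumTo (λ b → P X I b K) b)

  Ξ-slice : ∀ J → J ≤ n → Ξ X I J K ≡ + sumToℕ J multiplicity
  Ξ-slice J J≤n = begin
    Ξ X I J K                         ≡⟨ Ξ≡sumTo-P X I J K ⟩
    sumTo J (λ b → P X I b K)         ≡⟨ sumTo-cong J (λ b 1≤b b≤J →
                                           sym (ℤₚ.0≤i⇒+∣i∣≡i (P-nonneg b 1≤b (ℕₚ.≤-trans b≤J J≤n)))) ⟩
    sumTo J (λ b → + multiplicity b)  ≡⟨ sumTo-pos J multiplicity ⟩
    + sumToℕ J multiplicity           ∎
    where open ≡-Reasoning

  multiplicity-total : sumToℕ n multiplicity ≡ I * K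
  multiplicity-total =
    ℤₚ.+-injective (trans (sym (Ξ-slice n ℕₚ.≤-refl)) (proj₁ (proj₂ (fullFaces I K I≤n K≤n))))

slice-⪯Ξ⇔⪯Δ : ∀ {n} {A B : Hypermatrix n} → IsCornerSum n (Ξ A) → IsCornerSum n (Ξ B) →
  ∀ {I K} → I ≤ n → K ≤ n →
  (∀ J → 1 ≤ J → J ≤ n → Ξ B I J K ℤ.≤ Ξ A I J K) ⇔
  (∀ j → 1 ≤ j → j ≤ I * K → Δ A I j K ≤ Δ B I j K)
slice-⪯Ξ⇔⪯Δ {n} {A} {B} CA CB {I} {K} I≤n K≤n = mk⇔
  (λ Ξ-le j 1≤j j≤IK →
     Equivalence.to dominance (counts-dominate Ξ-le) j 1≤j (subst (j ≤_) (sym SA.multiplicity-total) j≤IK))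
  (λ Δ-le J 1≤J J≤n → subst₂ ℤ._≤_ (sym (SB.Ξ-slice J J≤n)) (sym (SA.Ξ-slice J J≤n)) (+≤+
     (Equivalence.from dominance (λ m 1≤m m≤S → Δ-le m 1≤m (subst (m ≤_) SA.multiplicity-total m≤S)) J J≤n)))
  where
  module SA = Slice CA I≤n K≤n
  module SB = Slice CB I≤n K≤n
  dominance : (∀ J → J ≤ n → sumToℕ J SB.multiplicity ≤ sumToℕ J SA.multiplicity) ⇔
              (∀ m → 1 ≤ m → m ≤ sumToℕ n SA.multiplicity → Δ A I m K ≤ Δ B I m K)
  dominance = ascending-dominance n SA.multiplicity SB.multiplicity
                (trans SA.multiplicity-total (sym SB.multiplicity-total))
  counts-dominate : (∀ J → 1 ≤ J → J ≤ n → Ξ B I J K ℤ.≤ Ξ A I J K) →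
    ∀ J → J ≤ n → sumToℕ J SB.multiplicity ≤ sumToℕ J SA.multiplicity
  counts-dominate Ξ-le zero    _   = z≤n
  counts-dominate Ξ-le (suc J) J≤n = ℤₚ.drop‿+≤+
    (subst₂ ℤ._≤_ (SB.Ξ-slice (suc J) J≤n) (SA.Ξ-slice (suc J) J≤n) (Ξ-le (suc J) (s≤s z≤n) J≤n))

⪯Ξ⇔⪯Δ : ∀ {n} {A B : Hypermatrix n} → IsCornerSum n (Ξ A) → IsCornerSum n (Ξ B) → A ⪯Ξ B ⇔ A ⪯Δ B
⪯Ξ⇔⪯Δ CA CB = mk⇔
  (λ A⪯B i k j 1≤i i≤n 1≤k k≤n →
     Equivalence.to (slice-⪯Ξ⇔⪯Δ CA CB i≤n k≤n) (λ J 1≤J J≤n → A⪯B i J k 1≤i i≤n 1≤J J≤n 1≤k k≤n) j)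
  (λ A⪯B I J K 1≤I I≤n 1≤J J≤n 1≤K K≤n →
     Equivalence.from (slice-⪯Ξ⇔⪯Δ CA CB I≤n K≤n) (λ j → A⪯B I K j 1≤I I≤n 1≤K K≤n) J 1≤J J≤n)

entryᴹ : ∀ {n} → Hypermatrix n → Maybe (Fin n) → Maybe (Fin n) → Maybe (Fin n) → ℤ
entryᴹ A (just i) (just j) (just k) = A i j k
entryᴹ A _        _        _        = + 0

entry≡entryᴹ : ∀ {n} (A : Hypermatrix n) a b c →
  entry A a b c ≡ entryᴹ A (toIdx n a) (toIdx n b) (toIdx n c)
entry≡entryᴹ {n} A a b c with toIdx n a | toIdx n b | toIdx n c
... | just i  | just j  | just k  = refl
... | nothing | _       | _       = refl
... | just i  | nothing | _       = refl
... | just i  | just j  | nothing = refl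

toIdx-toℕ : ∀ {n} (i : Fin n) → toIdx n (suc (toℕ i)) ≡ just i
toIdx-toℕ {n} i with toℕ i <? n
... | yes i<n = cong just (Finₚ.fromℕ<-toℕ i i<n)
... | no  i≮n = ⊥-elim (i≮n (Finₚ.toℕ<n i))

entry-toℕ : ∀ {n} (A : Hypermatrix n) i j k → entry A (suc (toℕ i)) (suc (toℕ j)) (suc (toℕ k)) ≡ A i j k
entry-toℕ A i j k rewrite entry≡entryᴹ A (suc (toℕ i)) (suc (toℕ j)) (suc (toℕ k))
                        | toIdx-toℕ i | toIdx-toℕ j | toIdx-toℕ k = refl

entry-cong : ∀ {n} {A B : Hypermatrix n} → (∀ i j k → A i j k ≡ B i j k) →
  ∀ a b c → entry A a b c ≡ entry B a b c
entry-cong {n} {A} {B} A≗B a b c = begin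
  entry A a b c                                 ≡⟨ entry≡entryᴹ A a b c ⟩
  entryᴹ A (toIdx n a) (toIdx n b) (toIdx n c)  ≡⟨ entryᴹ-cong (toIdx n a) (toIdx n b) (toIdx n c) ⟩
  entryᴹ B (toIdx n a) (toIdx n b) (toIdx n c)  ≡⟨ entry≡entryᴹ B a b c ⟨
  entry B a b c                                 ∎
  where
  open ≡-Reasoning
  entryᴹ-cong : ∀ ma mb mc → entryᴹ A ma mb mc ≡ entryᴹ B ma mb mc
  entryᴹ-cong (just i) (just j) (just k) = A≗B i j k
  entryᴹ-cong nothing  _        _        = refl
  entryᴹ-cong (just i) nothing  _        = refl
  entryᴹ-cong (just i) (just j) nothing  = refl

Ξ-cong : ∀ {n} {A B : Hypermatrix n} → (∀ i j k → A i j k ≡ B i j k) → ∀ I J K → Ξ A I J K ≡ Ξ B I J K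
Ξ-cong A≗B I J K =
  sumTo-cong I (λ a _ _ → sumTo-cong J (λ b _ _ → sumTo-cong K (λ c _ _ → entry-cong A≗B a b c)))

DiffersBySum : ∀ {n} → Hypermatrix n → Hypermatrix n → List (Hypermatrix n) → Set
DiffersBySum A B Ts = ∀ i j k → A i j k - B i j k ≡ sumℤ (map (λ T → T i j k) Ts)

entry-sub : ∀ {n} {A B : Hypermatrix n} {Ts} → DiffersBySum A B Ts →
  ∀ a b c → entry A a b c - entry B a b c ≡ sumℤ (map (λ T → entry T a b c) Ts)
entry-sub {n} {A} {B} {Ts} A-B≡ΣTs a b c = begin
  entry A a b c - entry B a b c
    ≡⟨ cong₂ _-_ (entry≡entryᴹ A a b c) (entry≡entryᴹ B a b c) ⟩
  entryᴹ A (toIdx n a) (toIdx n b) (toIdx n c) - entryᴹ B (toIdx n a) (toIdx n b) (toIdx n c)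
    ≡⟨ entryᴹ-sub (toIdx n a) (toIdx n b) (toIdx n c) ⟩
  sumℤ (map (λ T → entryᴹ T (toIdx n a) (toIdx n b) (toIdx n c)) Ts)
    ≡⟨ cong sumℤ (Listₚ.map-cong (λ T → sym (entry≡entryᴹ T a b c)) Ts) ⟩
  sumℤ (map (λ T → entry T a b c) Ts) ∎
  where
  open ≡-Reasoning
  entryᴹ-sub : ∀ ma mb mc →
    entryᴹ A ma mb mc - entryᴹ B ma mb mc ≡ sumℤ (map (λ T → entryᴹ T ma mb mc) Ts)
  entryᴹ-sub (just i) (just j) (just k) = A-B≡ΣTs i j k
  entryᴹ-sub nothing  _        _        = sym (sumℤ-zeros Ts)
  entryᴹ-sub (just i) nothing  _        = sym (sumℤ-zeros Ts)
  entryᴹ-sub (just i) (just j) nothing  = sym (sumℤ-zeros Ts)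

sumTo-sub : ∀ {X : Set} (xs : List X) m {f g : ℕ → ℤ} (h : X → ℕ → ℤ) →
  (∀ a → f a - g a ≡ sumℤ (map (λ x → h x a) xs)) →
  sumTo m f - sumTo m g ≡ sumℤ (map (λ x → sumTo m (h x)) xs)
sumTo-sub xs m {f} {g} h f-g≡Σh = begin
  sumTo m f - sumTo m g                        ≡⟨ sumTo-minus m f g ⟨
  sumTo m (λ a → f a - g a)                    ≡⟨ sumTo-cong m (λ a _ _ → f-g≡Σh a) ⟩
  sumTo m (λ a → sumℤ (map (λ x → h x a) xs))  ≡⟨ sumTo-sumℤ xs m h ⟩
  sumℤ (map (λ x → sumTo m (h x)) xs)          ∎
  where open ≡-Reasoning

Ξ-sub : ∀ {n} {A B : Hypermatrix n} {Ts} → DiffersBySum A B Ts →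
  ∀ I J K → Ξ A I J K - Ξ B I J K ≡ sumℤ (map (λ T → Ξ T I J K) Ts)
Ξ-sub {Ts = Ts} A-B≡ΣTs I J K =
  sumTo-sub Ts I (λ T a → sumTo J λ b → sumTo K λ c → entry T a b c) λ a →
  sumTo-sub Ts J (λ T b → sumTo K λ c → entry T a b c) λ b →
  sumTo-sub Ts K (λ T c → entry T a b c) λ c → entry-sub {Ts = Ts} A-B≡ΣTs a b c

∇³-Ξ : ∀ {n} (A : Hypermatrix n) x y z → ∇³ (Ξ A) x y z ≡ entry A (suc x) (suc y) (suc z)
∇³-Ξ A x y z = begin
  ∇³ (Ξ A) x y z
    ≡⟨ cong₂ _-_ (cong₂ _-_ (∇₁ (suc y) (suc z)) (∇₁ y (suc z))) (cong₂ _-_ (∇₁ (suc y) z) (∇₁ y z)) ⟩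
  ∇ (λ r → ∇ (λ q → slice q r) y) z
    ≡⟨ cong₂ _-_ (∇-sumTo (λ b → sumTo (suc z) (entry A (suc x) b)) y)
                 (∇-sumTo (λ b → sumTo z (entry A (suc x) b)) y) ⟩
  ∇ (λ r → sumTo r (entry A (suc x) (suc y))) z
    ≡⟨ ∇-sumTo (entry A (suc x) (suc y)) z ⟩
  entry A (suc x) (suc y) (suc z) ∎
  where
  open ≡-Reasoning
  slice : ℕ → ℕ → ℤ
  slice q r = sumTo q (λ b → sumTo r (entry A (suc x) b))
  ∇₁ : ∀ q r → ∇ (λ p → Ξ A p q r) x ≡ slice q r
  ∇₁ q r = ∇-sumTo (λ a → sumTo q (λ b → sumTo r (entry A a b))) x

-- T-blocks as outer products

outer : ∀ {n} → (Fin n → ℤ) → (Fin n → ℤ) → (Fin n → ℤ) → Hypermatrix n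
outer f g h i j k = f i ℤ.* g j ℤ.* h k

at : ∀ {n} → (Fin n → ℤ) → ℕ → ℤ
at {n} f a = maybe′ f (+ 0) (toIdx n a)

*-zero-middle : ∀ a c → a ℤ.* + 0 ℤ.* c ≡ + 0
*-zero-middle = solve-∀

entry-outer : ∀ {n} (f g h : Fin n → ℤ) a b c → entry (outer f g h) a b c ≡ at f a ℤ.* at g b ℤ.* at h c
entry-outer {n} f g h a b c =
  trans (entry≡entryᴹ (outer f g h) a b c) (entryᴹ-outer (toIdx n a) (toIdx n b) (toIdx n c))
  where
  entryᴹ-outer : ∀ ma mb mc →
    entryᴹ (outer f g h) ma mb mc ≡ maybe′ f (+ 0) ma ℤ.* maybe′ g (+ 0) mb ℤ.* maybe′ h (+ 0) mc
  entryᴹ-outer (just i) (just j) (just k) = refl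
  entryᴹ-outer nothing  _        _        = refl
  entryᴹ-outer (just i) nothing  mc       = sym (*-zero-middle (f i) (maybe′ h (+ 0) mc))
  entryᴹ-outer (just i) (just j) nothing  = sym (ℤₚ.*-zeroʳ (f i ℤ.* g j))

Ξ-outer : ∀ {n} (f g h : Fin n → ℤ) I J K →
  Ξ (outer f g h) I J K ≡ sumTo I (at f) ℤ.* sumTo J (at g) ℤ.* sumTo K (at h)
Ξ-outer f g h I J K = begin
  Ξ (outer f g h) I J K
    ≡⟨ sumTo-cong I (λ a _ _ → sumTo-cong J (λ b _ _ → sumTo-cong K (λ c _ _ → entry-outer f g h a b c))) ⟩
  sumTo I (λ a → sumTo J (λ b → sumTo K (λ c → at f a ℤ.* at g b ℤ.* at h c)))
    ≡⟨ sumTo-cong I (λ a _ _ → sumTo-cong J (λ b _ _ → sumTo-*ˡ K (at f a ℤ.* at g b) (at h))) ⟩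
  sumTo I (λ a → sumTo J (λ b → at f a ℤ.* at g b ℤ.* Hₖ))
    ≡⟨ sumTo-cong I (λ a _ _ → sumTo-*ʳ J Hₖ (λ b → at f a ℤ.* at g b)) ⟩
  sumTo I (λ a → sumTo J (λ b → at f a ℤ.* at g b) ℤ.* Hₖ)
    ≡⟨ sumTo-cong I (λ a _ _ → cong (ℤ._* Hₖ) (sumTo-*ˡ J (at f a) (at g))) ⟩
  sumTo I (λ a → at f a ℤ.* Gⱼ ℤ.* Hₖ)
    ≡⟨ sumTo-*ʳ I Hₖ (λ a → at f a ℤ.* Gⱼ) ⟩
  sumTo I (λ a → at f a ℤ.* Gⱼ) ℤ.* Hₖ
    ≡⟨ cong (ℤ._* Hₖ) (sumTo-*ʳ I Gⱼ (at f)) ⟩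
  sumTo I (at f) ℤ.* Gⱼ ℤ.* Hₖ ∎
  where
  open ≡-Reasoning
  Gⱼ Hₖ : ℤ
  Gⱼ = sumTo J (at g)
  Hₖ = sumTo K (at h)

unitDiff : ∀ {n} → ℕ → ℕ → Fin n → ℤ
unitDiff a b x = δ (toℕ x) a - δ (toℕ x) b

unitDiff-at₁ : ∀ {n} {x₁ x₂ : Fin n} → toℕ x₁ < toℕ x₂ → unitDiff (toℕ x₁) (toℕ x₂) x₁ ≡ + 1
unitDiff-at₁ {x₁ = x₁} x₁<x₂ = cong₂ _-_ (δ-refl (toℕ x₁)) (δ-≢ (ℕₚ.<⇒≢ x₁<x₂))

unitDiff-at₂ : ∀ {n} {x₁ x₂ : Fin n} → toℕ x₁ < toℕ x₂ → unitDiff (toℕ x₁) (toℕ x₂) x₂ ≡ - + 1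
unitDiff-at₂ {x₂ = x₂} x₁<x₂ = cong₂ _-_ (δ-≢ (ℕₚ.>⇒≢ x₁<x₂)) (δ-refl (toℕ x₂))

data UnitDiffView {n} (x₁ x₂ x : Fin n) : Set where
  at₁    : x ≡ x₁ → unitDiff (toℕ x₁) (toℕ x₂) x ≡ + 1   → UnitDiffView x₁ x₂ x
  at₂    : x ≡ x₂ → unitDiff (toℕ x₁) (toℕ x₂) x ≡ - + 1 → UnitDiffView x₁ x₂ x
  others : ¬ (x ≡ x₁ ⊎ x ≡ x₂) → unitDiff (toℕ x₁) (toℕ x₂) x ≡ + 0 → UnitDiffView x₁ x₂ x

unitDiffView : ∀ {n} {x₁ x₂ : Fin n} → toℕ x₁ < toℕ x₂ → ∀ x → UnitDiffView x₁ x₂ x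
unitDiffView {x₁ = x₁} {x₂} x₁<x₂ x with x Fin.≟ x₁ | x Fin.≟ x₂
... | yes refl | _        = at₁ refl (unitDiff-at₁ x₁<x₂)
... | no x≢x₁  | yes refl = at₂ refl (unitDiff-at₂ x₁<x₂)
... | no x≢x₁  | no x≢x₂  = others Sum.[ x≢x₁ , x≢x₂ ]
  (cong₂ _-_ (δ-≢ (x≢x₁ ∘ Finₚ.toℕ-injective)) (δ-≢ (x≢x₂ ∘ Finₚ.toℕ-injective)))

inCorners⊎vanishes : ∀ {n} {x₁ x₂ : Fin n} → toℕ x₁ < toℕ x₂ → ∀ x →
  (x ≡ x₁ ⊎ x ≡ x₂) ⊎ unitDiff (toℕ x₁) (toℕ x₂) x ≡ + 0
inCorners⊎vanishes x₁<x₂ x with unitDiffView x₁<x₂ x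
... | at₁ x≡x₁ _   = inj₁ (inj₁ x≡x₁)
... | at₂ x≡x₂ _   = inj₁ (inj₂ x≡x₂)
... | others _ u≡0 = inj₂ u≡0

blockOuter : ∀ {n} (i₁ i₂ j₁ j₂ k₁ k₂ : Fin n) → Hypermatrix n
blockOuter i₁ i₂ j₁ j₂ k₁ k₂ =
  outer (unitDiff (toℕ i₁) (toℕ i₂)) (unitDiff (toℕ j₁) (toℕ j₂)) (unitDiff (toℕ k₁) (toℕ k₂))

neg-last-factor : ∀ a b → - (a ℤ.* b ℤ.* + 1) ≡ a ℤ.* b ℤ.* - + 1
neg-last-factor = solve-∀

module _ {n} {T : Hypermatrix n} {i₁ i₂ j₁ j₂ k₁ k₂ : Fin n} (T-block : IsPosTBlockAt T i₁ i₂ j₁ j₂ k₁ k₂) where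
  open IsPosTBlockAt T-block

  private
    uI uJ : Fin n → ℤ
    uI = unitDiff (toℕ i₁) (toℕ i₂)
    uJ = unitDiff (toℕ j₁) (toℕ j₂)

    layer₁ : ∀ i j → T i j k₁ ≡ uI i ℤ.* uJ j ℤ.* + 1
    layer₁ i j with unitDiffView i<i i | unitDiffView j<j j
    ... | at₁ refl uᵢ | at₁ refl uⱼ rewrite uᵢ | uⱼ = v₁₁
    ... | at₁ refl uᵢ | at₂ refl uⱼ rewrite uᵢ | uⱼ = v₁₂
    ... | at₂ refl uᵢ | at₁ refl uⱼ rewrite uᵢ | uⱼ = v₂₁
    ... | at₂ refl uᵢ | at₂ refl uⱼ rewrite uᵢ | uⱼ = v₂₂
    ... | others i∉ uᵢ | _ rewrite uᵢ = zeroOutside i j k₁ (i∉ ∘ proj₁)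
    ... | at₁ _ _ | others j∉ uⱼ rewrite uⱼ =
      trans (zeroOutside i j k₁ (j∉ ∘ proj₁ ∘ proj₂)) (sym (*-zero-middle (uI i) (+ 1)))
    ... | at₂ _ _ | others j∉ uⱼ rewrite uⱼ =
      trans (zeroOutside i j k₁ (j∉ ∘ proj₁ ∘ proj₂)) (sym (*-zero-middle (uI i) (+ 1)))

  T-block≗blockOuter : ∀ i j k → T i j k ≡ blockOuter i₁ i₂ j₁ j₂ k₁ k₂ i j k
  T-block≗blockOuter i j k with unitDiffView k<k k
  ... | at₁ refl uₖ rewrite uₖ = layer₁ i j
  ... | at₂ refl uₖ rewrite uₖ = trans (flip i j) (trans (cong -_ (layer₁ i j)) (neg-last-factor (uI i) (uJ j)))
  ... | others k∉ uₖ rewrite uₖ =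
    trans (zeroOutside i j k (k∉ ∘ proj₂ ∘ proj₂)) (sym (ℤₚ.*-zeroʳ (uI i ℤ.* uJ j)))

blockOuter-IsPosTBlockAt : ∀ {n} {T : Hypermatrix n} {i₁ i₂ j₁ j₂ k₁ k₂ : Fin n} →
  toℕ i₁ < toℕ i₂ → toℕ j₁ < toℕ j₂ → toℕ k₁ < toℕ k₂ →
  (∀ i j k → T i j k ≡ blockOuter i₁ i₂ j₁ j₂ k₁ k₂ i j k) → IsPosTBlockAt T i₁ i₂ j₁ j₂ k₁ k₂
blockOuter-IsPosTBlockAt {n} {T} {i₁} {i₂} {j₁} {j₂} {k₁} {k₂} i₁<i₂ j₁<j₂ k₁<k₂ T≗ = record
  { i<i = i₁<i₂ ; j<j = j₁<j₂ ; k<k = k₁<k₂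
  ; zeroOutside = zeroOutside
  ; v₁₁ = trans (T≗ i₁ j₁ k₁) (*-cong₃ (unitDiff-at₁ i₁<i₂) (unitDiff-at₁ j₁<j₂) (unitDiff-at₁ k₁<k₂))
  ; v₂₂ = trans (T≗ i₂ j₂ k₁) (*-cong₃ (unitDiff-at₂ i₁<i₂) (unitDiff-at₂ j₁<j₂) (unitDiff-at₁ k₁<k₂))
  ; v₁₂ = trans (T≗ i₁ j₂ k₁) (*-cong₃ (unitDiff-at₁ i₁<i₂) (unitDiff-at₂ j₁<j₂) (unitDiff-at₁ k₁<k₂))
  ; v₂₁ = trans (T≗ i₂ j₁ k₁) (*-cong₃ (unitDiff-at₂ i₁<i₂) (unitDiff-at₁ j₁<j₂) (unitDiff-at₁ k₁<k₂))
  ; flip = flip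
  }
  where
  open ≡-Reasoning
  uI uJ uK : Fin n → ℤ
  uI = unitDiff (toℕ i₁) (toℕ i₂)
  uJ = unitDiff (toℕ j₁) (toℕ j₂)
  uK = unitDiff (toℕ k₁) (toℕ k₂)

  *-cong₃ : ∀ {a b c a′ b′ c′} → a ≡ a′ → b ≡ b′ → c ≡ c′ → a ℤ.* b ℤ.* c ≡ a′ ℤ.* b′ ℤ.* c′
  *-cong₃ a≡a′ b≡b′ c≡c′ = cong₂ ℤ._*_ (cong₂ ℤ._*_ a≡a′ b≡b′) c≡c′

  flip : ∀ i j → T i j k₂ ≡ - T i j k₁
  flip i j = begin
    T i j k₂                     ≡⟨ T≗ i j k₂ ⟩
    uI i ℤ.* uJ j ℤ.* uK k₂      ≡⟨ cong (uI i ℤ.* uJ j ℤ.*_) (unitDiff-at₂ k₁<k₂) ⟩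
    uI i ℤ.* uJ j ℤ.* - + 1      ≡⟨ neg-last-factor (uI i) (uJ j) ⟨
    - (uI i ℤ.* uJ j ℤ.* + 1)    ≡⟨ cong (λ u → - (uI i ℤ.* uJ j ℤ.* u)) (unitDiff-at₁ k₁<k₂) ⟨
    - (uI i ℤ.* uJ j ℤ.* uK k₁)  ≡⟨ cong -_ (T≗ i j k₁) ⟨
    - T i j k₁                   ∎

  zeroOutside : ∀ i j k → ¬ ((i ≡ i₁ ⊎ i ≡ i₂) × (j ≡ j₁ ⊎ j ≡ j₂) × (k ≡ k₁ ⊎ k ≡ k₂)) → T i j k ≡ + 0
  zeroOutside i j k ∉corners
    with inCorners⊎vanishes i₁<i₂ i | inCorners⊎vanishes j₁<j₂ j | inCorners⊎vanishes k₁<k₂ k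
  ... | inj₂ uI≡0 | _         | _         =
    trans (T≗ i j k) (cong (λ u → u ℤ.* uJ j ℤ.* uK k) uI≡0)
  ... | inj₁ _    | inj₂ uJ≡0 | _         =
    trans (T≗ i j k) (trans (cong (λ u → uI i ℤ.* u ℤ.* uK k) uJ≡0) (*-zero-middle (uI i) (uK k)))
  ... | inj₁ _    | inj₁ _    | inj₂ uK≡0 =
    trans (T≗ i j k) (trans (cong (uI i ℤ.* uJ j ℤ.*_) uK≡0) (ℤₚ.*-zeroʳ (uI i ℤ.* uJ j)))
  ... | inj₁ i∈   | inj₁ j∈   | inj₁ k∈   = ⊥-elim (∉corners (i∈ , j∈ , k∈))

at-unitDiff : ∀ {n a b} → a < n → b < n → ∀ c → at (unitDiff {n} a b) c ≡ δ c (suc a) - δ c (suc b)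
at-unitDiff {n} a<n b<n zero = refl
at-unitDiff {n} a<n b<n (suc c) with c <? n
... | yes c<n rewrite Finₚ.toℕ-fromℕ< c<n = refl
... | no  c≮n = sym (cong₂ _-_ (δ-≢ (c≮n ∘ λ c≡a → subst (_< n) (sym c≡a) a<n))
                               (δ-≢ (c≮n ∘ λ c≡b → subst (_< n) (sym c≡b) b<n)))

sumTo-unitDiff-nonneg : ∀ {n a b} → a < b → b < n → ∀ I → + 0 ℤ.≤ sumTo I (at (unitDiff {n} a b))
sumTo-unitDiff-nonneg a<b b<n I =
  subst (+ 0 ℤ.≤_) (sym (sumTo-cong I (λ c _ _ → at-unitDiff (ℕₚ.<-trans a<b b<n) b<n c)))
        (sumTo-δ-diff-nonneg I (s≤s z≤n) (s≤s a<b))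

*-nonneg : ∀ {a b} → + 0 ℤ.≤ a → + 0 ℤ.≤ b → + 0 ℤ.≤ a ℤ.* b
*-nonneg {+ m} {+ k} _ _ = subst (+ 0 ℤ.≤_) (ℤₚ.pos-* m k) (+≤+ z≤n)

Ξ-T-block-nonneg : ∀ {n} {T : Hypermatrix n} → IsPosTBlock T → ∀ I J K → + 0 ℤ.≤ Ξ T I J K
Ξ-T-block-nonneg (i₁ , i₂ , j₁ , j₂ , k₁ , k₂ , T-block) I J K =
  subst (+ 0 ℤ.≤_) (sym (trans (Ξ-cong (T-block≗blockOuter T-block) I J K) (Ξ-outer _ _ _ I J K)))
    (*-nonneg (*-nonneg (sumTo-unitDiff-nonneg i<i (Finₚ.toℕ<n i₂) I)
                        (sumTo-unitDiff-nonneg j<j (Finₚ.toℕ<n j₂) J))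
              (sumTo-unitDiff-nonneg k<k (Finₚ.toℕ<n k₂) K))
  where open IsPosTBlockAt T-block

⪯B⇒⪯Ξ : ∀ {n} {A B : Hypermatrix n} → A ⪯B B → A ⪯Ξ B
⪯B⇒⪯Ξ (Ts , T-blocks , A-B≡ΣTs) I J K _ _ _ _ _ _ =
  ℤₚ.0≤i-j⇒j≤i (subst (+ 0 ℤ.≤_) (sym (Ξ-sub {Ts = Ts} A-B≡ΣTs I J K))
    (sumℤ-nonneg (λ T → Ξ T I J K) (All.map (λ T-block → Ξ-T-block-nonneg T-block I J K) T-blocks)))

-- Decomposition into elementary T-blocks

module Decomposition {n′} {A B : Hypermatrix (suc n′)}
  (CA : IsCornerSum (suc n′) (Ξ A)) (CB : IsCornerSum (suc n′) (Ξ B)) (A⪯ΞB : A ⪯Ξ B) where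

  D : ℕ → ℕ → ℕ → ℤ
  D p q r = Ξ A p q r - Ξ B p q r

  -- ∇-weight x (suc p) ≡ unitDiff p (suc p) x definitionally, so E (suc p) (suc q) (suc r)
  -- is the positive T-block with corners p, p + 1 in each direction (0-based).
  E : ℕ → ℕ → ℕ → Hypermatrix (suc n′)
  E p q r = outer (λ i → ∇-weight (toℕ i) p) (λ j → ∇-weight (toℕ j) q) (λ k → ∇-weight (toℕ k) r)

  cuts : List ℕ
  cuts = map suc (upTo n′)

  blocks : List (Hypermatrix (suc n′))
  blocks = concatMap (λ r → concatMap (λ q → concatMap (λ p → replicate ∣ D p q r ∣ (E p q r)) cuts) cuts) cuts

  E-isPosTBlock : ∀ {p q r} → p < n′ → q < n′ → r < n′ → IsPosTBlock (E (suc p) (suc q) (suc r))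
  E-isPosTBlock p<n′ q<n′ r<n′ = _ , _ , _ , _ , _ , _ ,
    blockOuter-IsPosTBlockAt (lo<hi p<n′) (lo<hi q<n′) (lo<hi r<n′) (λ i j k →
      cong₂ ℤ._*_ (cong₂ ℤ._*_ (weight≡unitDiff p<n′ i) (weight≡unitDiff q<n′ j)) (weight≡unitDiff r<n′ k))
    where
    lo<hi : ∀ {p} (p<n′ : p < n′) → toℕ (fromℕ< (ℕₚ.m≤n⇒m≤1+n p<n′)) < toℕ (fromℕ< (s≤s p<n′))
    lo<hi p<n′ rewrite Finₚ.toℕ-fromℕ< (ℕₚ.m≤n⇒m≤1+n p<n′) | Finₚ.toℕ-fromℕ< (s≤s p<n′) = ℕₚ.≤-refl
    weight≡unitDiff : ∀ {p} (p<n′ : p < n′) x →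
      ∇-weight (toℕ x) (suc p) ≡ unitDiff (toℕ (fromℕ< (ℕₚ.m≤n⇒m≤1+n p<n′))) (toℕ (fromℕ< (s≤s p<n′))) x
    weight≡unitDiff p<n′ x rewrite Finₚ.toℕ-fromℕ< (ℕₚ.m≤n⇒m≤1+n p<n′) | Finₚ.toℕ-fromℕ< (s≤s p<n′) = refl

  blocks-isPosTBlock : All IsPosTBlock blocks
  blocks-isPosTBlock =
    All-concatMap-range _ n′ λ { (suc r) _ r≤n′ →
    All-concatMap-range _ n′ λ { (suc q) _ q≤n′ →
    All-concatMap-range _ n′ λ { (suc p) _ p≤n′ →
    Allₚ.replicate⁺ _ (E-isPosTBlock p≤n′ q≤n′ r≤n′) } } }

  D-vanishes : VanishesOnBoundary (suc n′) D
  D-vanishes = record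
    { face₁ = λ q r q≤ r≤ →
        agree (proj₂ (proj₂ (zeroFaces CA q r q≤ r≤))) (proj₂ (proj₂ (zeroFaces CB q r q≤ r≤))) ,
        agree (proj₂ (proj₂ (fullFaces CA q r q≤ r≤))) (proj₂ (proj₂ (fullFaces CB q r q≤ r≤)))
    ; face₂ = λ p r p≤ r≤ →
        agree (proj₁ (proj₂ (zeroFaces CA p r p≤ r≤))) (proj₁ (proj₂ (zeroFaces CB p r p≤ r≤))) ,
        agree (proj₁ (proj₂ (fullFaces CA p r p≤ r≤))) (proj₁ (proj₂ (fullFaces CB p r p≤ r≤)))
    ; face₃ = λ p q p≤ q≤ →
        agree (proj₁ (zeroFaces CA p q p≤ q≤)) (proj₁ (zeroFaces CB p q p≤ q≤)) ,
        agree (proj₁ (fullFaces CA p q p≤ q≤)) (proj₁ (fullFaces CB p q p≤ q≤))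
    }
    where
    open IsCornerSum
    agree : ∀ {a b c : ℤ} → a ≡ c → b ≡ c → a - b ≡ + 0
    agree a≡c b≡c = ℤₚ.i≡j⇒i-j≡0 (trans a≡c (sym b≡c))

  D-nonneg : ∀ {p q r} → 1 ≤ p → p ≤ n′ → 1 ≤ q → q ≤ n′ → 1 ≤ r → r ≤ n′ → + 0 ℤ.≤ D p q r
  D-nonneg {p} {q} {r} 1≤p p≤n′ 1≤q q≤n′ 1≤r r≤n′ = ℤₚ.i≤j⇒0≤j-i
    (A⪯ΞB p q r 1≤p (ℕₚ.m≤n⇒m≤1+n p≤n′) 1≤q (ℕₚ.m≤n⇒m≤1+n q≤n′) 1≤r (ℕₚ.m≤n⇒m≤1+n r≤n′))

  A-B≡Σblocks : DiffersBySum A B blocks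
  A-B≡Σblocks i j k = sym (begin
    sumℤ (map entryAt blocks)
      ≡⟨ sumℤ-concatMap-range entryAt _ n′ ⟩
    sumTo n′ (λ r → sumℤ (map entryAt
      (concatMap (λ q → concatMap (λ p → replicate ∣ D p q r ∣ (E p q r)) cuts) cuts)))
      ≡⟨ sumTo-cong n′ (λ r _ _ → trans (sumℤ-concatMap-range entryAt _ n′) (sumTo-cong n′ (λ q _ _ →
           trans (sumℤ-concatMap-range entryAt _ n′) (sumTo-cong n′ (λ p _ _ →
             sumℤ-replicate entryAt ∣ D p q r ∣ (E p q r)))))) ⟩
    sumTo n′ (λ r → sumTo n′ (λ q → sumTo n′ (λ p → + ∣ D p q r ∣ ℤ.* E p q r i j k)))
      ≡⟨ sumTo-cong n′ (λ r 1≤r r≤n′ → sumTo-cong n′ (λ q 1≤q q≤n′ → sumTo-cong n′ (λ p 1≤p p≤n′ →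
           cong (ℤ._* E p q r i j k) (ℤₚ.0≤i⇒+∣i∣≡i (D-nonneg 1≤p p≤n′ 1≤q q≤n′ 1≤r r≤n′))))) ⟩
    sumTo n′ (λ r → sumTo n′ (λ q → sumTo n′ (λ p → D p q r ℤ.* E p q r i j k)))
      ≡⟨ sumTo³-∇³ n′ D D-vanishes (≤n′ i) (≤n′ j) (≤n′ k) ⟩
    ∇³ D x y z
      ≡⟨ ∇³-sub (Ξ A) (Ξ B) x y z ⟩
    ∇³ (Ξ A) x y z - ∇³ (Ξ B) x y z
      ≡⟨ cong₂ _-_ (∇³-Ξ A x y z) (∇³-Ξ B x y z) ⟩
    entry A (suc x) (suc y) (suc z) - entry B (suc x) (suc y) (suc z)
      ≡⟨ cong₂ _-_ (entry-toℕ A i j k) (entry-toℕ B i j k) ⟩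
    A i j k - B i j k ∎)
    where
    open ≡-Reasoning
    entryAt : Hypermatrix (suc n′) → ℤ
    entryAt T = T i j k
    x y z : ℕ
    x = toℕ i
    y = toℕ j
    z = toℕ k
    ≤n′ : (w : Fin (suc n′)) → toℕ w ≤ n′
    ≤n′ w = ℕₚ.≤-pred (Finₚ.toℕ<n w)

⪯Ξ⇒⪯B : ∀ {n} {A B : Hypermatrix n} → IsCornerSum n (Ξ A) → IsCornerSum n (Ξ B) → A ⪯Ξ B → A ⪯B B
⪯Ξ⇒⪯B {zero}   _  _  _     = [] , [] , λ ()
⪯Ξ⇒⪯B {suc n′} CA CB A⪯ΞB = blocks , blocks-isPosTBlock , A-B≡Σblocks
  where open Decomposition CA CB A⪯ΞB

mainTheorem9 : (n : ℕ) (A B : Hypermatrix n) →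
    IsCornerSum n (Ξ A) → IsCornerSum n (Ξ B) →
    (A ⪯B B) ⇔ (∀ i k j → 1 ≤ i → i ≤ n → 1 ≤ k → k ≤ n → 1 ≤ j → j ≤ i * k →
                  Δ A i j k ≤ Δ B i j k)
mainTheorem9 n A B CA CB = ⇔-trans (mk⇔ ⪯B⇒⪯Ξ (⪯Ξ⇒⪯B CA CB)) (⪯Ξ⇔⪯Δ CA CB)
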